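{- Let $G$ be a strongly connected graph with $N$ nodes, girth $g$ and cyclicity $\gamma$. Then the exploration penalty $ep$ of $G$ is finite and \[ ep \le \min\Big\{ N+(N-2)g\ ,\ 2\frac{g}{\gamma}N - \frac{g}{\gamma} - 2g + \gamma\Big\}. \]
   Context: Graphs are directed graphs $(V,E)$ with $V$ finite nonempty and $E\subseteq V\times V$. A walk is a finite sequence of consecutive edges (possibly empty); a closed walk starts and ends at the same node; a cycle is a closed walk containing no nonempty closed walk as a proper subwalk. The girth $g$ is the minimal length of a nonempty cycle (so $G$ is assumed to contain a nonempty cycle); the cyclicity $\gamma$ of a strongly connected graph is the gcd of its cycle lengths. The exploration penalty $ep(G)$ is the least integer $e$ such that for every node $i$ and every integer $n\ge e$ that is a multiple of $\gamma$, there is a closed walk of length $n$ starting at $i$. -}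

module Defs where

open import Data.Nat using (ℕ; zero; suc; _<_; _≤_; _/_)
open import Data.Nat.Divisibility using (_∣_)
open import Data.Fin using (Fin; toℕ; inject₁; fromℕ)
import Data.Fin as F
open import Data.Bool using (Bool; true)
open import Data.Product using (Σ; ∃; _×_)
open import Relation.Binary.PropositionalEquality using (_≡_)
open import Relation.Nullary using (¬_)
open import Data.Integer as ℤ using (ℤ; +_)

record Graph : Set where
  field
    N        : ℕ
    nonempty : 1 ≤ N
    E        : Fin N → Fin N → Bool

module _ (G : Graph) where
  open Graph G

  IsWalk : (n : ℕ) → (Fin (suc n) → Fin N) → Set
  IsWalk n v = ∀ (k : Fin n) → E (v (inject₁ k)) (v (F.suc k)) ≡ true

  Closed : (n : ℕ) → (Fin (suc n) → Fin N) → Set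
  Closed n v = v F.zero ≡ v (fromℕ n)

  HasProperClosedSubwalk : (n : ℕ) → (Fin (suc n) → Fin N) → Set
  HasProperClosedSubwalk n v =
    Σ (Fin (suc n)) λ a → Σ (Fin (suc n)) λ b →
      (toℕ a < toℕ b) × (v a ≡ v b) × ¬ ((toℕ a ≡ 0) × (toℕ b ≡ n))

  IsCycle : (n : ℕ) → (Fin (suc n) → Fin N) → Set
  IsCycle n v = IsWalk n v × Closed n v × ¬ HasProperClosedSubwalk n v

  CycleLength : ℕ → Set
  CycleLength n = (1 ≤ n) × Σ (Fin (suc n) → Fin N) (IsCycle n)

  WalkOfLength : Fin N → Fin N → ℕ → Set
  WalkOfLength i j n =
    Σ (Fin (suc n) → Fin N) λ v → IsWalk n v × (v F.zero ≡ i) × (v (fromℕ n) ≡ j)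

  StronglyConnected : Set
  StronglyConnected = ∀ (i j : Fin N) → ∃ λ n → WalkOfLength i j n

  IsGirth : ℕ → Set
  IsGirth g = CycleLength g × (∀ m → CycleLength m → g ≤ m)

  IsCyclicity : ℕ → Set
  IsCyclicity γ = (∀ m → CycleLength m → γ ∣ m)
                × (∀ d → (∀ m → CycleLength m → d ∣ m) → d ∣ γ)

  Explores : ℕ → ℕ → Set
  Explores γ e = ∀ (i : Fin N) (n : ℕ) → e ≤ n → γ ∣ n → WalkOfLength i i n

  IsExplorationPenalty : ℕ → ℕ → Set
  IsExplorationPenalty γ e = Explores γ e × (∀ e' → Explores γ e' → e ≤ e')

-- natural-number quotient, with the (irrelevant) convention m ÷ 0 = 0
_÷_ : ℕ → ℕ → ℕ
m ÷ zero = 0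
m ÷ suc k = m / suc k

bound : ℕ → ℕ → ℕ → ℤ
bound N g γ =
  ((+ N) ℤ.+ ((+ N) ℤ.- + 2) ℤ.* (+ g))
  ℤ.⊓ ((+ 2) ℤ.* (+ (g ÷ γ)) ℤ.* (+ N) ℤ.- (+ (g ÷ γ)) ℤ.- (+ 2) ℤ.* (+ g) ℤ.+ (+ γ))

module Submission where

-- Fix a cycle C of minimal length g and put q = g/γ. Every closed walk has length divisible by γ, so
-- two positions of a walk at the same node are congruent modulo γ; if they also lie in the same block
-- ⌊(s mod g)/γ⌋ they are congruent modulo g, and the closed subwalk between them can be excised
-- without changing the length modulo g. Pigeonholing over the N·q pairs (node, block) thus shortens
-- every walk below N·q while keeping its length modulo g.
-- Every node i is reached from some node of C by a path of length at most N − g. The lengths modulo g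
-- of the closed walks at i that go to that node and return along this path are closed under addition,
-- hence form a subgroup of ℤ/g; it contains every cycle length, hence every multiple of γ. A short
-- such walk padded with turns around C has any length n ≥ N·q + N − 2g with γ ∣ n, and this value
-- is below both expressions of the bound.

open import Defs
open import Data.Nat using (ℕ)
open import Data.Product using (∃; _×_)
open import Data.Integer using (+_; _≤_)

import Data.Nat as Nat
open Nat using (zero; suc; pred; _+_; _*_; _∸_; _<_; _<?_; _≤?_; z≤n; s≤s; _/_; _%_; NonZero)
import Data.Nat.Properties as NP
open import Data.Nat.Divisibility as ND using (_∣_; divides; _∣?_)
open import Data.Nat.DivMod
open import Data.Nat.Induction using (<-rec)
open import Data.Nat.Tactic.RingSolver using (solve-∀)
import Data.Integer as ℤ
import Data.Integer.Properties as ZP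
open import Data.Integer.Tactic.RingSolver using () renaming (solve-∀ to ℤ-solve-∀)
open import Data.Fin as F using (Fin; toℕ; fromℕ; fromℕ<)
import Data.Fin.Properties as FP
open import Data.Bool using (true)
import Data.Bool.Properties as BP
open import Data.Product using (_,_; proj₁; proj₂; ∃₂)
open import Data.Empty using (⊥-elim)
open import Relation.Nullary using (¬_; Dec; yes; no; ¬?; _×-dec_; _→-dec_)
open import Relation.Unary using (Decidable)
open import Relation.Binary.PropositionalEquality

module _ {P : ℕ → Set} (P? : Decidable P) where

  least-witness : ∀ {n} → P n → ∃ λ m → P m × (∀ {k} → k < m → ¬ P k)
  least-witness {n} = <-rec _ step n
    where
    step : ∀ n → (∀ {m} → m < n → P m → ∃ λ m → P m × (∀ {k} → k < m → ¬ P k)) →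
           P n → ∃ λ m → P m × (∀ {k} → k < m → ¬ P k)
    step n rec pn with NP.anyUpTo? P? n
    ... | yes (m , m<n , pm) = rec m<n pm
    ... | no none = n , pn , λ k<n pk → none (_ , k<n , pk)

pigeonhole-ℕ : ∀ {m n} → m < n → (f : ℕ → Fin m) →
               ∃₂ λ s s' → s < s' × s' < n × f s ≡ f s'
pigeonhole-ℕ m<n f with FP.pigeonhole m<n (λ x → f (toℕ x))
... | x , y , x<y , fx≡fy = toℕ x , toℕ y , x<y , FP.toℕ<n y , fx≡fy

m+n≡o∧0<n⇒m<o : ∀ {m n o} → m + n ≡ o → 0 < n → m < o
m+n≡o∧0<n⇒m<o {m} refl 0<n = NP.m<m+n m 0<n

m+n≡o∧0<m⇒n<o : ∀ {m n o} → m + n ≡ o → 0 < m → n < o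
m+n≡o∧0<m⇒n<o {n = n} refl 0<m = NP.m<n+m n 0<m

module _ {d : ℕ} .{{_ : NonZero d}} where

  %-cong-+ : ∀ {m n o p} → m % d ≡ n % d → o % d ≡ p % d → (m + o) % d ≡ (n + p) % d
  %-cong-+ {m} {n} {o} {p} m≡n o≡p = begin
    (m + o) % d             ≡⟨ %-distribˡ-+ m o d ⟩
    (m % d + o % d) % d     ≡⟨ cong₂ (λ x y → (x + y) % d) m≡n o≡p ⟩
    (n % d + p % d) % d     ≡⟨ %-distribˡ-+ n p d ⟨
    (n + p) % d             ∎
    where open ≡-Reasoning

  m≤n∧d∣n∸m⇒m%d≡n%d : ∀ {m n} → m Nat.≤ n → d ∣ n ∸ m → m % d ≡ n % d
  m≤n∧d∣n∸m⇒m%d≡n%d {m} {n} m≤n d∣n∸m = begin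
    m % d              ≡⟨ %-remove-+ʳ m d∣n∸m ⟨
    (m + (n ∸ m)) % d  ≡⟨ cong (_% d) (NP.m+[n∸m]≡n m≤n) ⟩
    n % d              ∎
    where open ≡-Reasoning

  m%d≡n%d⇒d∣n∸m : ∀ m n → m % d ≡ n % d → d ∣ n ∸ m
  m%d≡n%d⇒d∣n∸m m n m≡n = divides (n / d ∸ m / d) (begin
    n ∸ m                                      ≡⟨ cong₂ _∸_ (m≡m%n+[m/n]*n n d) (m≡m%n+[m/n]*n m d) ⟩
    (n % d + n / d * d) ∸ (m % d + m / d * d)  ≡⟨ cong (λ r → (r + n / d * d) ∸ (m % d + m / d * d)) (sym m≡n) ⟩
    (m % d + n / d * d) ∸ (m % d + m / d * d)  ≡⟨ NP.[m+n]∸[m+o]≡n∸o (m % d) _ _ ⟩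
    n / d * d ∸ m / d * d                      ≡⟨ NP.*-distribʳ-∸ d (n / d) (m / d) ⟨
    (n / d ∸ m / d) * d                        ∎)
    where open ≡-Reasoning

  m%d≡n%d∧m<n+d⇒n≡m+kd : ∀ {m n} → m % d ≡ n % d → m < n + d → ∃ λ k → n ≡ m + k * d
  m%d≡n%d∧m<n+d⇒n≡m+kd {m} {n} m≡n m<n+d with m Nat.≤? n
  ... | yes m≤n with m%d≡n%d⇒d∣n∸m m n m≡n
  ...   | divides k n∸m≡kd = k , trans (sym (NP.m+[n∸m]≡n m≤n)) (cong (_+_ m) n∸m≡kd)
  m%d≡n%d∧m<n+d⇒n≡m+kd {m} {n} m≡n m<n+d | no m≰n =
    ⊥-elim (NP.<⇒≱ (NP.m<n+o⇒m∸n<o m n m<n+d) (ND.∣⇒≤ {{Nat.>-nonZero (NP.m<n⇒0<n∸m n<m)}} d∣m∸n))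
    where
    n<m : n < m
    n<m = NP.≰⇒> m≰n
    d∣m∸n : d ∣ m ∸ n
    d∣m∸n = m%d≡n%d⇒d∣n∸m n m (sym m≡n)

m%d≡n%d∧[m%o]/d≡[n%o]/d⇒m%o≡n%o :
  ∀ {m n o d} .{{_ : NonZero o}} .{{_ : NonZero d}} → d ∣ o →
  m % d ≡ n % d → (m % o) / d ≡ (n % o) / d → m % o ≡ n % o
m%d≡n%d∧[m%o]/d≡[n%o]/d⇒m%o≡n%o {m} {n} {o} {d} d∣o m≡n blocks≡ = begin
  m % o                        ≡⟨ m≡m%n+[m/n]*n (m % o) d ⟩
  m % o % d + m % o / d * d    ≡⟨ cong₂ _+_ residues≡ (cong (_* d) blocks≡) ⟩
  n % o % d + n % o / d * d    ≡⟨ m≡m%n+[m/n]*n (n % o) d ⟨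
  n % o                        ∎
  where
  open ≡-Reasoning
  residues≡ : m % o % d ≡ n % o % d
  residues≡ = trans (m∣n⇒o%n%m≡o%m d o m d∣o) (trans m≡n (sym (m∣n⇒o%n%m≡o%m d o n d∣o)))

+≤-from-ℕ : ∀ {a b c} (x : ℤ.ℤ) → a + c Nat.≤ b → x ℤ.+ + c ≡ + b → + a ≤ x
+≤-from-ℕ {a} {b} {c} x a+c≤b x+c≡b = begin
  + a                    ≡⟨ ZP.+-identityʳ (+ a) ⟨
  + a ℤ.+ ℤ.0ℤ           ≡⟨ cong (ℤ._+_ (+ a)) (ZP.+-inverseʳ (+ c)) ⟨
  + a ℤ.+ (+ c ℤ.- + c)  ≡⟨ ZP.+-assoc (+ a) (+ c) (ℤ.- + c) ⟨
  + (a + c) ℤ.- + c      ≤⟨ ZP.+-monoˡ-≤ (ℤ.- + c) (ℤ.+≤+ a+c≤b) ⟩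
  + b ℤ.- + c            ≡⟨ cong (ℤ._- + c) x+c≡b ⟨
  x ℤ.+ + c ℤ.- + c      ≡⟨ ZP.+-assoc x (+ c) (ℤ.- + c) ⟩
  x ℤ.+ (+ c ℤ.- + c)    ≡⟨ cong (ℤ._+_ x) (ZP.+-inverseʳ (+ c)) ⟩
  x ℤ.+ ℤ.0ℤ             ≡⟨ ZP.+-identityʳ x ⟩
  x                      ∎
  where open ZP.≤-Reasoning

N*q+N+q≤2*q*N+γ : ∀ N q γ .{{_ : NonZero N}} .{{_ : NonZero q}} .{{_ : NonZero γ}} →
                  N * q + N + q Nat.≤ 2 * q * N + γ
N*q+N+q≤2*q*N+γ (suc N) (suc q) (suc γ) =
  begin
  suc N * suc q + suc N + suc q                ≤⟨ NP.m≤m+n _ (q * N + γ) ⟩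
  suc N * suc q + suc N + suc q + (q * N + γ)  ≡⟨ split N q γ ⟨
  2 * suc q * suc N + suc γ                    ∎
  where
  open NP.≤-Reasoning
  split : ∀ N q γ → 2 * suc q * suc N + suc γ ≡ (suc N * suc q + suc N + suc q) + (q * N + γ)
  split = solve-∀

module Paths (G : Graph) where
  open Graph G

  infixr 5 _∷_ _++_

  data Path : Fin N → Fin N → ℕ → Set where
    []  : ∀ {i} → Path i i 0
    _∷_ : ∀ {i k j n} → E i k ≡ true → Path k j n → Path i j (suc n)

  -- Positions beyond the end of the path all name its last node.
  node : ∀ {i j n} → Path i j n → ℕ → Fin N
  node {i} p        zero    = i
  node {i} []       (suc s) = i
  node     (_ ∷ p)  (suc s) = node p s

  node-end : ∀ {i j n} (p : Path i j n) {s} → n Nat.≤ s → node p s ≡ j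
  node-end []      {zero}  _       = refl
  node-end []      {suc s} _       = refl
  node-end (e ∷ p) {suc s} (s≤s h) = node-end p h

  edge-at : ∀ {i j n} (p : Path i j n) {s} → s < n → E (node p s) (node p (suc s)) ≡ true
  edge-at (e ∷ p) {zero}  _       = e
  edge-at (e ∷ p) {suc s} (s≤s h) = edge-at p h

  _++_ : ∀ {i k j m n} → Path i k m → Path k j n → Path i j (m + n)
  []      ++ q = q
  (e ∷ p) ++ q = e ∷ (p ++ q)

  take : ∀ {i j n} (p : Path i j n) s → s Nat.≤ n → Path i (node p s) s
  take p       zero    _       = []
  take (e ∷ p) (suc s) (s≤s h) = e ∷ take p s h

  drop : ∀ {i j n} (p : Path i j n) s → Path (node p s) j (n ∸ s)
  drop p       zero    = p
  drop []      (suc s) = []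
  drop (_ ∷ p) (suc s) = drop p s

  node-drop : ∀ {i j n} (p : Path i j n) s t → node (drop p s) t ≡ node p (s + t)
  node-drop p       zero    t       = refl
  node-drop []      (suc s) zero    = refl
  node-drop []      (suc s) (suc t) = refl
  node-drop (_ ∷ p) (suc s) t       = node-drop p s t

  repeat : ∀ {k n} → Path k k n → ∀ t → Path k k (t * n)
  repeat c zero    = []
  repeat c (suc t) = c ++ repeat c t

  rotate : ∀ {k n} (c : Path k k n) u → u Nat.≤ n → Path (node c u) (node c u) n
  rotate {n = n} c u u≤n = subst (Path _ _) (NP.m∸n+n≡m u≤n) (drop c u ++ take c u u≤n)

  module _ {i j n} (p : Path i j n) {s s'} (s≤s' : s Nat.≤ s') (s'≤n : s' Nat.≤ n)
           (loop : node p s ≡ node p s') where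

    excise : Path i j (s + (n ∸ s'))
    excise = take p s (NP.≤-trans s≤s' s'≤n) ++ subst (λ k → Path k j (n ∸ s')) (sym loop) (drop p s')

    segment : Path (node p s) (node p s) (s' ∸ s)
    segment = subst (λ k → Path (node p s) k (s' ∸ s)) returns (take (drop p s) (s' ∸ s) (NP.∸-monoˡ-≤ s s'≤n))
      where
      returns : node (drop p s) (s' ∸ s) ≡ node p s
      returns = trans (node-drop p s (s' ∸ s)) (trans (cong (node p) (NP.m+[n∸m]≡n s≤s')) (sym loop))

    excise-length : (s + (n ∸ s')) + (s' ∸ s) ≡ n
    excise-length = begin
      (s + (n ∸ s')) + (s' ∸ s)  ≡⟨ NP.+-assoc s (n ∸ s') (s' ∸ s) ⟩
      s + ((n ∸ s') + (s' ∸ s))  ≡⟨ cong (_+_ s) (NP.+-comm (n ∸ s') (s' ∸ s)) ⟩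
      s + ((s' ∸ s) + (n ∸ s'))  ≡⟨ NP.+-assoc s (s' ∸ s) (n ∸ s') ⟨
      (s + (s' ∸ s)) + (n ∸ s')  ≡⟨ cong (_+ (n ∸ s')) (NP.m+[n∸m]≡n s≤s') ⟩
      s' + (n ∸ s')              ≡⟨ NP.m+[n∸m]≡n s'≤n ⟩
      n                          ∎
      where open ≡-Reasoning

  nodes : ∀ {i j n} → Path i j n → Fin (suc n) → Fin N
  nodes p k = node p (toℕ k)

  nodes-walk : ∀ {i j n} (p : Path i j n) → IsWalk G n (nodes p)
  nodes-walk p k rewrite FP.toℕ-inject₁ k = edge-at p (FP.toℕ<n k)

  nodes-end : ∀ {i j n} (p : Path i j n) → nodes p (fromℕ n) ≡ j
  nodes-end {n = n} p = node-end p (NP.≤-reflexive (sym (FP.toℕ-fromℕ n)))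

  toWalk : ∀ {i j n} → Path i j n → WalkOfLength G i j n
  toWalk p = nodes p , nodes-walk p , refl , nodes-end p

  fromWalk : ∀ {j} n (v : Fin (suc n) → Fin N) → IsWalk G n v → v (fromℕ n) ≡ j → Path (v F.zero) j n
  fromWalk zero    v w refl = []
  fromWalk (suc n) v w end  = w F.zero ∷ fromWalk n (λ k → v (F.suc k)) (λ k → w (F.suc k)) end

  node-fromWalk : ∀ {j} n (v : Fin (suc n) → Fin N) (w : IsWalk G n v) (end : v (fromℕ n) ≡ j)
                  {s} (s≤n : s < suc n) → node (fromWalk n v w end) s ≡ v (fromℕ< s≤n)
  node-fromWalk zero    v w refl {zero}  _         = refl
  node-fromWalk zero    v w refl {suc s} (s≤s ())
  node-fromWalk (suc n) v w end  {zero}  _         = refl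
  node-fromWalk (suc n) v w end  {suc s} (s≤s s≤n) =
    node-fromWalk n (λ k → v (F.suc k)) (λ k → w (F.suc k)) end s≤n

  fromWalkOfLength : ∀ {i j n} → WalkOfLength G i j n → Path i j n
  fromWalkOfLength {n = n} (v , w , refl , end) = fromWalk n v w end

  path? : ∀ n i j → Dec (Path i j n)
  path? zero i j with i FP.≟ j
  ... | yes refl = yes []
  ... | no i≢j   = no λ { [] → i≢j refl }
  path? (suc n) i j with FP.any? (λ k → (E i k BP.≟ true) ×-dec path? n k j)
  ... | yes (k , e , p) = yes (e ∷ p)
  ... | no none         = no λ { (_∷_ {k = k} e p) → none (k , e , p) }

  hasProperClosedSubwalk? : ∀ n v → Dec (HasProperClosedSubwalk G n v)
  hasProperClosedSubwalk? n v =
    FP.any? λ a → FP.any? λ b →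
      (toℕ a <? toℕ b) ×-dec (v a FP.≟ v b) ×-dec ¬? ((toℕ a Nat.≟ 0) ×-dec (toℕ b Nat.≟ n))

module ClosedPaths (G : Graph) where
  open Paths G

  proper⇒0<outer-length : ∀ n {s s'} → s' Nat.≤ suc n → ¬ ((s ≡ 0) × (s' ≡ suc n)) →
                          0 < s + (suc n ∸ s')
  proper⇒0<outer-length n {suc s} _ _ = s≤s z≤n
  proper⇒0<outer-length n {zero} {s'} s'≤ proper with s' Nat.≟ suc n
  ... | yes s'≡ = ⊥-elim (proper (refl , s'≡))
  ... | no s'≢  = NP.m<n⇒0<n∸m (NP.≤∧≢⇒< s'≤ s'≢)

  -- A closed walk that is not a cycle splits at a repeated node into two shorter closed walks.
  ∣-closed-path-length : ∀ {d} → (∀ m → CycleLength G m → d ∣ m) → ∀ {j n} → Path j j n → d ∣ n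
  ∣-closed-path-length {d} d∣cycles {n = n} = <-rec (λ n → ∀ {j} → Path j j n → d ∣ n) step n
    where
    step : ∀ n → (∀ {m} → m < n → ∀ {j} → Path j j m → d ∣ m) → ∀ {j} → Path j j n → d ∣ n
    step zero    _   _ = d ND.∣0
    step (suc n) rec p with hasProperClosedSubwalk? (suc n) (nodes p)
    ... | no  simple = d∣cycles (suc n) (s≤s z≤n , nodes p , nodes-walk p , sym (nodes-end p) , simple)
    ... | yes (a , b , a<b , loop , proper) =
      subst (d ∣_) split
        (ND.∣m∣n⇒∣m+n (rec (m+n≡o∧0<n⇒m<o split (NP.m<n⇒0<n∸m a<b)) (excise p s≤s' s'≤n loop))
                      (rec (m+n≡o∧0<m⇒n<o split (proper⇒0<outer-length n s'≤n proper))
                           (segment p s≤s' s'≤n loop)))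
      where
      s≤s' : toℕ a Nat.≤ toℕ b
      s≤s' = NP.<⇒≤ a<b
      s'≤n : toℕ b Nat.≤ suc n
      s'≤n = NP.≤-pred (FP.toℕ<n b)
      split : (toℕ a + (suc n ∸ toℕ b)) + (toℕ b ∸ toℕ a) ≡ suc n
      split = excise-length p s≤s' s'≤n loop

  cyclePath : ∀ {n v} → IsCycle G n v → Path (v F.zero) (v F.zero) n
  cyclePath {n} {v} (w , closed , _) = fromWalk n v w (sym closed)

  cyclePath-simple : ∀ {n v} (c : IsCycle G n v) {a b} → a < b → b < n →
                     node (cyclePath c) a ≢ node (cyclePath c) b
  cyclePath-simple {n} {v} c@(w , closed , simple) {a} {b} a<b b<n same =
    simple (fromℕ< a<1+n , fromℕ< b<1+n , a<b' , same' , not-whole)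
    where
    b<1+n : b < suc n
    b<1+n = NP.<-trans b<n (NP.n<1+n n)
    a<1+n : a < suc n
    a<1+n = NP.<-trans a<b b<1+n
    a<b' : toℕ (fromℕ< a<1+n) < toℕ (fromℕ< b<1+n)
    a<b' = subst₂ _<_ (sym (FP.toℕ-fromℕ< a<1+n)) (sym (FP.toℕ-fromℕ< b<1+n)) a<b
    same' : v (fromℕ< a<1+n) ≡ v (fromℕ< b<1+n)
    same' = trans (sym (node-fromWalk n v w (sym closed) a<1+n))
                  (trans same (node-fromWalk n v w (sym closed) b<1+n))
    not-whole : ¬ ((toℕ (fromℕ< a<1+n) ≡ 0) × (toℕ (fromℕ< b<1+n) ≡ n))
    not-whole (_ , b≡n) = NP.<-irrefl (trans (sym (FP.toℕ-fromℕ< b<1+n)) b≡n) b<n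

module _ (G : Graph) (γ e : ℕ) where
  open Paths G

  -- Given Explores γ e, the property Explores γ e' only concerns the finitely many lengths below e.
  private
    ExploresBelow : ℕ → Set
    ExploresBelow e' = ∀ {n} → n < e → e' Nat.≤ n → γ ∣ n → ∀ i → WalkOfLength G i i n

    ExploresBelow? : Decidable ExploresBelow
    ExploresBelow? e' = NP.allUpTo? (λ n → e' ≤? n →-dec γ ∣? n →-dec FP.all? (λ i → walk? i n)) e
      where
      walk? : ∀ i n → Dec (WalkOfLength G i i n)
      walk? i n with path? n i i
      ... | yes p = yes (toWalk p)
      ... | no ¬p = no (λ w → ¬p (fromWalkOfLength w))

    explores⇒below : ∀ {e'} → Explores G γ e' → ExploresBelow e'
    explores⇒below ex _ e'≤n γ∣n i = ex i _ e'≤n γ∣n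

  exploration-penalty-exists : Explores G γ e → ∃ λ e₀ → IsExplorationPenalty G γ e₀ × e₀ Nat.≤ e
  exploration-penalty-exists explores
    with least-witness ExploresBelow? {e} (λ n<e e≤n → ⊥-elim (NP.<⇒≱ n<e e≤n))
  ... | e₀ , below , minimal = e₀ , (explores₀ , least) , least e explores
    where
    explores₀ : Explores G γ e₀
    explores₀ i n e₀≤n γ∣n with n <? e
    ... | yes n<e = below n<e e₀≤n γ∣n i
    ... | no  n≮e = explores i n (NP.≮⇒≥ n≮e) γ∣n
    least : ∀ e' → Explores G γ e' → e₀ Nat.≤ e'
    least e' ex = NP.≮⇒≥ (λ e'<e₀ → minimal e'<e₀ (explores⇒below ex))

module NearestCycleNode (G : Graph) {k n} .{{_ : NonZero n}} (C : Paths.Path G k k n)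
  (simple : ∀ {a b} → a < b → b < n → Paths.node G C a ≢ Paths.node G C b) where
  open Graph G
  open Paths G

  record Anchor (i : Fin N) : Set where
    field
      entry      : ℕ
      entry<n    : entry < n
      depth      : ℕ
      descent    : Path (node C entry) i depth
      depth+n≤N  : depth + n Nat.≤ N

  private
    label : ∀ {i b} u → Path (node C u) i b → ∀ s → Dec (s < b) → Fin N
    label u p s (yes _) = node p (suc s)
    label {b = b} u _ s (no _) = node C (s ∸ b)

  -- While b + n > N, the b + n nodes p(1), …, p(b), C(0), …, C(n − 1) repeat (C itself is simple):
  -- the repetition encloses a loop of p, or lets p start later at a node of C.
  anchor : ∀ {i b u} → u < n → Path (node C u) i b → Anchor i
  anchor {i} {b} = <-rec (λ b → ∀ {u} → u < n → Path (node C u) i b → Anchor i) step b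
    where
    step : ∀ b → (∀ {b'} → b' < b → ∀ {u} → u < n → Path (node C u) i b' → Anchor i) →
           ∀ {u} → u < n → Path (node C u) i b → Anchor i
    step b rec {u} u<n p with (b + n) Nat.≤? N
    ... | yes fits = record { entry = u ; entry<n = u<n ; depth = b ; descent = p ; depth+n≤N = fits }
    ... | no overflow with pigeonhole-ℕ (NP.≰⇒> overflow) (λ s → label u p s (s <? b))
    ... | s , s' , s<s' , s'<b+n , same = resolve (s <? b) (s' <? b) same
      where
      resolve : (d : Dec (s < b)) (d' : Dec (s' < b)) → label u p s d ≡ label u p s' d' → Anchor i
      resolve (yes _) (yes s'<b) same =
        rec (m+n≡o∧0<n⇒m<o (excise-length p 1+s≤1+s' s'<b same) (NP.m<n⇒0<n∸m (s≤s s<s')))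
            u<n (excise p 1+s≤1+s' s'<b same)
        where
        1+s≤1+s' : suc s Nat.≤ suc s'
        1+s≤1+s' = s≤s (NP.<⇒≤ s<s')
      resolve (yes s<b) (no s'≮b) same =
        rec (NP.∸-monoʳ-< (s≤s z≤n) s<b) (NP.m<n+o⇒m∸n<o s' b s'<b+n)
            (subst (λ k → Path k i (b ∸ suc s)) same (drop p (suc s)))
      resolve (no s≮b) (yes s'<b) _ = ⊥-elim (s≮b (NP.<-trans s<s' s'<b))
      resolve (no s≮b) (no _) same =
        ⊥-elim (simple (NP.∸-monoˡ-< s<s' (NP.≮⇒≥ s≮b)) (NP.m<n+o⇒m∸n<o s' b s'<b+n) same)

module Shortening (G : Graph) (g γ : ℕ) .{{_ : NonZero g}} .{{_ : NonZero γ}} (γ∣g : γ ∣ g)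
  (γ∣closed : ∀ {j n} → Paths.Path G j j n → γ ∣ n) where
  open Graph G
  open Paths G

  q : ℕ
  q = g / γ

  block< : ∀ s → (s % g) / γ < q
  block< s = m<n*o⇒m/o<n (subst ((s % g) <_) (sym (m/n*n≡m γ∣g)) (m%n<n s g))

  Shortened : Fin N → Fin N → ℕ → Set
  Shortened x y a = ∃ λ a' → a' < N * q × a' % g ≡ a % g × Path x y a'

  excise-repetition : ∀ {x y a} (p : Path x y a) {s s'} → s < s' → s' Nat.≤ a →
                      node p s ≡ node p s' → (s % g) / γ ≡ (s' % g) / γ →
                      ∃ λ b → b < a × b % g ≡ a % g × Path x y b
  excise-repetition {a = a} p {s} {s'} s<s' s'≤a loop same-block =
    _ , m+n≡o∧0<n⇒m<o cut (NP.m<n⇒0<n∸m s<s') ,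
    trans (sym (%-remove-+ʳ _ g∣loop)) (cong (_% g) cut) , excise p s≤s' s'≤a loop
    where
    s≤s' : s Nat.≤ s'
    s≤s' = NP.<⇒≤ s<s'
    cut : (s + (a ∸ s')) + (s' ∸ s) ≡ a
    cut = excise-length p s≤s' s'≤a loop
    same-residue : s % γ ≡ s' % γ
    same-residue = m≤n∧d∣n∸m⇒m%d≡n%d s≤s' (γ∣closed (segment p s≤s' s'≤a loop))
    g∣loop : g ∣ s' ∸ s
    g∣loop = m%d≡n%d⇒d∣n∸m s s' (m%d≡n%d∧[m%o]/d≡[n%o]/d⇒m%o≡n%o γ∣g same-residue same-block)

  shorten : ∀ {x y a} → Path x y a → Shortened x y a
  shorten {x} {y} {a} = <-rec (λ a → Path x y a → Shortened x y a) step a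
    where
    state : ∀ {a} → Path x y a → ℕ → Fin (N * q)
    state p s = F.combine (node p s) (fromℕ< (block< s))

    step : ∀ a → (∀ {a'} → a' < a → Path x y a' → Shortened x y a') → Path x y a → Shortened x y a
    step a rec p with a <? N * q
    ... | yes short = a , short , refl , p
    ... | no long with pigeonhole-ℕ (s≤s (NP.≮⇒≥ long)) (state p)
    ... | s , s' , s<s' , s'<1+a , same with FP.combine-injective _ _ _ _ same
    ... | loop , same-block
          with excise-repetition p s<s' (NP.≤-pred s'<1+a) loop (FP.fromℕ<-injective _ _ _ _ same-block)
    ... | b , b<a , b≡a , p' with rec b<a p'
    ... | a' , a'<Nq , a'≡b , p'' = a' , a'<Nq , trans a'≡b b≡a , p''

module Exploration (G : Graph) (g γ : ℕ) .{{_ : NonZero g}} .{{_ : NonZero γ}}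
  (sc : StronglyConnected G) (girth : IsGirth G g) (cyclicity : IsCyclicity G γ) where
  open Graph G
  open Paths G
  open ClosedPaths G

  path-between : ∀ i j → ∃ (Path i j)
  path-between i j = proj₁ (sc i j) , fromWalkOfLength (proj₂ (sc i j))

  γ∣g : γ ∣ g
  γ∣g = proj₁ cyclicity g (proj₁ girth)

  girth-nodes : Fin (suc g) → Fin N
  girth-nodes = proj₁ (proj₂ (proj₁ girth))

  girth-cycle : IsCycle G g girth-nodes
  girth-cycle = proj₂ (proj₂ (proj₁ girth))

  c₀ : Fin N
  c₀ = girth-nodes F.zero

  C : Path c₀ c₀ g
  C = cyclePath girth-cycle

  open NearestCycleNode G C (cyclePath-simple girth-cycle)
  open Shortening G g γ γ∣g (∣-closed-path-length (proj₁ cyclicity))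

  anchor-of : ∀ i → Anchor i
  anchor-of i = anchor (Nat.>-nonZero⁻¹ g) (proj₂ (path-between c₀ i))

  Ep : ℕ
  Ep = (N * q + N) ∸ (g + g)

  0<q : 0 < q
  0<q = NP.n≢0⇒n>0 λ q≡0 → Nat.≢-nonZero⁻¹ g (trans (sym (m/n*n≡m γ∣g)) (cong (_* γ) q≡0))

  g≤N : g Nat.≤ N
  g≤N = NP.≤-trans (NP.m≤n+m g _) (Anchor.depth+n≤N (anchor-of c₀))

  Ep+2g≡Nq+N : Ep + (g + g) ≡ N * q + N
  Ep+2g≡Nq+N = NP.m∸n+n≡m (NP.+-mono-≤ (NP.≤-trans g≤N (NP.m≤m*n N q {{Nat.>-nonZero 0<q}})) g≤N)

  module AtNode (i : Fin N) where
    open Anchor (anchor-of i)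

    hub : Fin N
    hub = node C entry

    -- x is attainable if some closed walk at i, made of a path to the hub followed by the
    -- descent, has length x modulo g.
    record Attainable (x : ℕ) : Set where
      constructor attained
      field
        steps   : ℕ
        route   : Path i hub steps
        residue : (steps + depth) % g ≡ x % g

    attainable-cong : ∀ {x y} → x % g ≡ y % g → Attainable x → Attainable y
    attainable-cong x≡y (attained a p r) = attained a p (trans r x≡y)

    attainable-+ : ∀ {x y} → Attainable x → Attainable y → Attainable (x + y)
    attainable-+ (attained a p r) (attained b p' r') =
      attained (a + (depth + b)) (p ++ descent ++ p')
        (trans (cong (_% g) (regroup a b depth)) (%-cong-+ r r'))
      where
      regroup : ∀ a b d → a + (d + b) + d ≡ (a + d) + (b + d)
      regroup = solve-∀

    attainable-suc* : ∀ {x} k → Attainable x → Attainable (suc k * x)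
    attainable-suc* {x} zero    h = attainable-cong (cong (_% g) (sym (NP.+-identityʳ x))) h
    attainable-suc*     (suc k) h = attainable-+ h (attainable-suc* k h)

    attainable-0 : Attainable 0
    attainable-0 = attainable-cong (g·x≡0 _) (attainable-suc* (pred g) start)
      where
      start : Attainable (proj₁ (path-between i hub) + depth)
      start = attained _ (proj₂ (path-between i hub)) refl
      g·x≡0 : ∀ x → (suc (pred g) * x) % g ≡ 0 % g
      g·x≡0 x = trans (cong (λ m → (m * x) % g) (NP.suc-pred g)) (%-remove-+ʳ 0 (ND.m∣m*n x))

    attainable-* : ∀ {x} k → Attainable x → Attainable (k * x)
    attainable-* zero    _ = attainable-0
    attainable-* (suc k) h = attainable-suc* k h

    -- Adding g − 1 copies of y subtracts y modulo g.
    attainable-cancel : ∀ {x y} → Attainable (x + y) → Attainable y → Attainable x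
    attainable-cancel {x} {y} hxy hy = attainable-cong x+g·y≡x (attainable-+ hxy (attainable-* (pred g) hy))
      where
      x+g·y≡x : ((x + y) + pred g * y) % g ≡ x % g
      x+g·y≡x = begin
        ((x + y) + pred g * y) % g   ≡⟨ cong (_% g) (NP.+-assoc x y (pred g * y)) ⟩
        (x + suc (pred g) * y) % g   ≡⟨ cong (λ m → (x + m * y) % g) (NP.suc-pred g) ⟩
        (x + g * y) % g              ≡⟨ %-remove-+ʳ x (ND.m∣m*n y) ⟩
        x % g                        ∎
        where open ≡-Reasoning

    attainable-cycle : ∀ {m} → CycleLength G m → Attainable m
    attainable-cycle {m} (_ , v , c) = via (path-between i (v F.zero)) (path-between (v F.zero) hub)
      where
      regroup : ∀ m a₁ a₂ d → a₁ + (m + a₂) + d ≡ m + (a₁ + a₂ + d)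
      regroup = solve-∀

      via : ∃ (Path i (v F.zero)) → ∃ (Path (v F.zero) hub) → Attainable m
      via (a₁ , p₁) (a₂ , p₂) =
        attainable-cancel (attainable-cong (cong (_% g) (regroup m a₁ a₂ depth))
                                           (attained _ (p₁ ++ cyclePath c ++ p₂) refl))
                          (attained _ (p₁ ++ p₂) refl)

    attainable? : Decidable Attainable
    attainable? x with NP.anyUpTo? (λ a → path? a i hub ×-dec ((a + depth) % g Nat.≟ x % g)) (N * q)
    ... | yes (a , _ , p , r) = yes (attained a p r)
    ... | no none = no λ (attained a p r) →
      let (a' , a'<Nq , a'≡a , p') = shorten p in none (a' , a'<Nq , p' , trans (%-cong-+ a'≡a refl) r)

    -- The least positive attainable d divides every cycle length, hence γ.
    γ-multiple-attainable : ∀ {n} → γ ∣ n → Attainable n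
    γ-multiple-attainable {n} γ∣n
      with least-witness (λ d → 0 <? d ×-dec attainable? d) {g}
             (Nat.>-nonZero⁻¹ g , attainable-cong (sym (%-remove-+ʳ 0 ND.∣-refl)) attainable-0)
    ... | d , (0<d , attainable-d) , minimal with ND.∣-trans (proj₂ cyclicity d d∣cycles) γ∣n
      where
      instance
        _ : NonZero d
        _ = Nat.>-nonZero 0<d
      d∣cycles : ∀ m → CycleLength G m → d ∣ m
      d∣cycles m c with m % d Nat.≟ 0
      ... | yes r≡0 = ND.m%n≡0⇒n∣m m d r≡0
      ... | no  r≢0 = ⊥-elim (minimal (m%n<n m d) (NP.n≢0⇒n>0 r≢0 , attainable-r))
        where
        attainable-r : Attainable (m % d)
        attainable-r = attainable-cancel (attainable-cong (cong (_% g) (m≡m%n+[m/n]*n m d)) (attainable-cycle c))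
                                         (attainable-* (m / d) attainable-d)
    ... | divides k n≡kd = subst Attainable (sym n≡kd) (attainable-* k attainable-d)

    closed-walk : ∀ {n} → Ep Nat.≤ n → γ ∣ n → WalkOfLength G i i n
    closed-walk {n} Ep≤n γ∣n = from-attained (γ-multiple-attainable γ∣n)
      where
      regroup : ∀ a t g d → a + (t * g + d) ≡ a + d + t * g
      regroup = solve-∀

      fits : ∀ {a'} → a' < N * q → a' + depth < n + g
      fits {a'} a'<Nq = NP.+-cancelʳ-≤ g (suc (a' + depth)) (n + g) (begin
        suc (a' + depth) + g  ≡⟨ NP.+-assoc (suc a') depth g ⟩
        suc a' + (depth + g)  ≤⟨ NP.+-mono-≤ a'<Nq depth+n≤N ⟩
        N * q + N             ≡⟨ Ep+2g≡Nq+N ⟨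
        Ep + (g + g)          ≤⟨ NP.+-monoˡ-≤ (g + g) Ep≤n ⟩
        n + (g + g)           ≡⟨ NP.+-assoc n g g ⟨
        n + g + g             ∎)
        where open NP.≤-Reasoning

      from-attained : Attainable n → WalkOfLength G i i n
      from-attained (attained a p r) =
        let (a' , a'<Nq , a'≡a , p') = shorten p
            (t , n≡a'+d+tg) = m%d≡n%d∧m<n+d⇒n≡m+kd (trans (%-cong-+ a'≡a refl) r) (fits a'<Nq)
        in toWalk (subst (Path i i) (trans (regroup a' t g depth) (sym n≡a'+d+tg))
                         (p' ++ repeat (rotate C entry (NP.<⇒≤ entry<n)) t ++ descent))

  explores : Explores G γ Ep
  explores i n Ep≤n γ∣n = AtNode.closed-walk i Ep≤n γ∣n

penalty-below-bound : ∀ {N g γ e} → 0 < N → 0 < γ → 0 < g ÷ γ → g ÷ γ Nat.≤ g →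
                      e + (g + g) ≡ N * (g ÷ γ) + N → + e ≤ bound N g γ
penalty-below-bound {N} {g} {γ} {e} 0<N 0<γ 0<q q≤g e+2g≡ = ZP.⊓-glb first second
  where
  q : ℕ
  q = g ÷ γ
  instance
    _ : NonZero γ
    _ = Nat.>-nonZero 0<γ
    _ : NonZero N
    _ = Nat.>-nonZero 0<N
    _ : NonZero q
    _ = Nat.>-nonZero 0<q
  first-term second-term : ℤ.ℤ
  first-term  = + N ℤ.+ (+ N ℤ.- + 2) ℤ.* + g
  second-term = + 2 ℤ.* + q ℤ.* + N ℤ.- + q ℤ.- + 2 ℤ.* + g ℤ.+ + γ

  first : + e ≤ first-term
  first = +≤-from-ℕ first-term e+2g≤ identity
    where
    e+2g≤ : e + (g + g) Nat.≤ N + N * g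
    e+2g≤ = subst₂ Nat._≤_ (sym e+2g≡) (NP.+-comm (N * g) N) (NP.+-monoˡ-≤ N (NP.*-monoʳ-≤ N q≤g))
    ring : ∀ n g → n ℤ.+ (n ℤ.- + 2) ℤ.* g ℤ.+ (g ℤ.+ g) ≡ n ℤ.+ n ℤ.* g
    ring = ℤ-solve-∀
    identity : first-term ℤ.+ + (g + g) ≡ + (N + N * g)
    identity = begin
      first-term ℤ.+ + (g + g)       ≡⟨ cong (ℤ._+_ first-term) (ZP.pos-+ g g) ⟩
      first-term ℤ.+ (+ g ℤ.+ + g)   ≡⟨ ring (+ N) (+ g) ⟩
      + N ℤ.+ + N ℤ.* + g            ≡⟨ cong (ℤ._+_ (+ N)) (ZP.pos-* N g) ⟨
      + (N + N * g)                  ∎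
      where open ≡-Reasoning

  second : + e ≤ second-term
  second = +≤-from-ℕ second-term e+q+2g≤ identity
    where
    regroup : ∀ e q h → e + (q + h) ≡ e + h + q
    regroup = solve-∀
    e+q+2g≤ : e + (q + (g + g)) Nat.≤ 2 * q * N + γ
    e+q+2g≤ = begin
      e + (q + (g + g))  ≡⟨ regroup e q (g + g) ⟩
      e + (g + g) + q    ≡⟨ cong (_+ q) e+2g≡ ⟩
      N * q + N + q      ≤⟨ N*q+N+q≤2*q*N+γ N q γ ⟩
      2 * q * N + γ      ∎
      where open NP.≤-Reasoning
    ring : ∀ n q g c → + 2 ℤ.* q ℤ.* n ℤ.- q ℤ.- + 2 ℤ.* g ℤ.+ c ℤ.+ (q ℤ.+ (g ℤ.+ g)) ≡ + 2 ℤ.* q ℤ.* n ℤ.+ c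
    ring = ℤ-solve-∀
    identity : second-term ℤ.+ + (q + (g + g)) ≡ + (2 * q * N + γ)
    identity = begin
      second-term ℤ.+ + (q + (g + g))        ≡⟨ cong (ℤ._+_ second-term) (trans (ZP.pos-+ q (g + g)) (cong (ℤ._+_ (+ q)) (ZP.pos-+ g g))) ⟩
      second-term ℤ.+ (+ q ℤ.+ (+ g ℤ.+ + g)) ≡⟨ ring (+ N) (+ q) (+ g) (+ γ) ⟩
      + 2 ℤ.* + q ℤ.* + N ℤ.+ + γ            ≡⟨ cong (ℤ._+ + γ) (trans (ZP.pos-* (2 * q) N) (cong (ℤ._* + N) (ZP.pos-* 2 q))) ⟨
      + (2 * q * N + γ)                      ∎
      where open ≡-Reasoning

theorem3 : (G : Graph) → (g γ : ℕ) →
    StronglyConnected G → IsGirth G g → IsCyclicity G γ →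
    ∃ λ e → IsExplorationPenalty G γ e × (+ e) ≤ bound (Graph.N G) g γ
theorem3 G zero γ _ ((() , _) , _) _
theorem3 G (suc g) zero _ (cycle , _) (0∣cycles , _) with ND.0∣⇒≡0 (0∣cycles (suc g) cycle)
... | ()
theorem3 G g@(suc _) γ@(suc _) sc girth cyclicity =
  let (e₀ , penalty , e₀≤Ep) = exploration-penalty-exists G γ Ep explores
  in e₀ , penalty , ZP.≤-trans (ℤ.+≤+ e₀≤Ep) Ep≤bound
  where
  open Exploration G g γ sc girth cyclicity
  Ep≤bound : + Ep ≤ bound (Graph.N G) g γ
  Ep≤bound = penalty-below-bound {γ = γ} (Graph.nonempty G) (s≤s z≤n) 0<q (m/n≤m g γ) Ep+2g≡Nq+N
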